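{- Let $m\ge 3$ and $n\ge 2$ be integers. The grid graph $P_m\,\Box\,P_n$ (Cartesian product of the paths on $m$ and $n$ vertices) satisfies $md(P_m\,\Box\,P_n)=3$.
   Context: For vertices $u,v$ of a connected graph $G$, $d(u,v)$ is the length of a shortest $u$–$v$ path. For $W\subseteq V(G)$ and $v\in V(G)$, $r_m(v|W)$ is the multiset $\{d(v,w): w\in W\}$. $W$ is an m-resolving set if $r_m(u|W)\neq r_m(v|W)$ for all distinct $u,v\in V(G)$. If $G$ has an m-resolving set, $md(G)$ is the minimum cardinality of one; otherwise $md(G)=\infty$. -}

module Defs where

open import Data.Nat using (ℕ; zero; suc; _≤_)
open import Data.Nat.Properties using () renaming (_≟_ to _≟ℕ_)
open import Data.Bool using (Bool; true; false; _∧_; _∨_)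
open import Data.List using (List; []; _∷_; map; length; cartesianProduct)
open import Data.Bool.ListAction using (any)
open import Data.List.Membership.Propositional using (_∈_)
open import Data.List.Relation.Unary.Unique.Propositional using (Unique)
open import Data.List.Relation.Binary.Permutation.Propositional using (_↭_)
open import Data.Fin using (Fin; toℕ)
open import Data.Fin.Properties using () renaming (_≟_ to _≟F_)
open import Data.List using (allFin)
open import Data.Product using (_×_; _,_; ∃)
open import Relation.Binary.PropositionalEquality using (_≡_; _≢_)
open import Relation.Binary.Definitions using (DecidableEquality)
open import Data.Product.Properties using (≡-dec)
open import Data.List.Membership.Propositional.Properties using (∈-cartesianProduct⁺; ∈-allFin)
open import Relation.Nullary using (¬_; does)

record FinGraph : Set₁ where
  field
    V        : Set
    _≟V_     : DecidableEquality V
    verts    : List V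
    complete : ∀ v → v ∈ verts
    adj      : V → V → Bool

module _ (G : FinGraph) where
  open FinGraph G

  within : ℕ → V → V → Bool
  within zero    u v = does (u ≟V v)
  within (suc k) u v = within k u v ∨ any (λ w → within k u w ∧ adj w v) verts

  -- least k ≤ bound with a walk of length ≤ k (returns bound if none)
  search : ℕ → ℕ → V → V → ℕ
  search k zero      u v = k
  search k (suc fuel) u v with within k u v
  ... | true  = k
  ... | false = search (suc k) fuel u v

  -- d(u,v): length of a shortest u–v path (in a connected graph every
  -- shortest path has length < number of vertices)
  dist : V → V → ℕ
  dist u v = search 0 (length verts) u v

  -- r_m(v | W) as a list; multiset equality is permutation equality
  rm : V → List V → List ℕ
  rm v W = map (dist v) W

  IsMResolving : List V → Set
  IsMResolving W = Unique W × (∀ u v → u ≢ v → ¬ (rm u W ↭ rm v W))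

  MDimIs : ℕ → Set
  MDimIs k = (∃ λ W → IsMResolving W × length W ≡ k)
           × (∀ W → IsMResolving W → k ≤ length W)

dist1 : ℕ → ℕ → Bool
dist1 a b = does (suc a ≟ℕ b) ∨ does (suc b ≟ℕ a)

gridAdj : ∀ {m n} → Fin m × Fin n → Fin m × Fin n → Bool
gridAdj (i , j) (i' , j') =
  (does (i ≟F i') ∧ dist1 (toℕ j) (toℕ j')) ∨ (does (j ≟F j') ∧ dist1 (toℕ i) (toℕ i'))

grid : ℕ → ℕ → FinGraph
grid m n = record
  { V        = Fin m × Fin n
  ; _≟V_     = ≡-dec _≟F_ _≟F_
  ; verts    = cartesianProduct (allFin m) (allFin n)
  ; complete = λ { (i , j) → ∈-cartesianProduct⁺ (∈-allFin i) (∈-allFin j) }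
  ; adj      = gridAdj
  }

-- In any finite graph, a function δ that vanishes exactly on
--    the diagonal, grows by at most one along edges, admits a one-step-closer
--    predecessor and is bounded by the number of vertices coincides with the
--    walk-search `dist` (module PathMetric).  The taxicab distance satisfies
--    this on the grid, so r_m(u | W) is the list of taxicab distances.
-- 2. Lower bound.  With no landmark any two vertices agree; with one landmark
--    w, a row- and a column-neighbour of w are both at distance 1; with two
--    landmarks a, b, the profiles of a and b are {0, d} and {d, 0}.
-- 3. Upper bound.  Seen from a point at depth x beside a line of positions
--    0 … K+1, opposite position y, the landmarks 0, 1, K+1 of that line have
--    distances {t, t+1, c}.  For K ≥ 2 such a multiset determines (x, y): equal
--    pairs (t, c) are handled by cancellation, and the only other way two
--    such multisets can agree would make K both even and odd.  Applied to the
--    first row (n ≥ 4) or the first column (m ≥ 4) this gives a resolving set of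
--    size 3; the grids 3 × 2 and 3 × 3 are verified by exhaustive computation,
--    comparing sorted distance profiles.
module Submission where

open import Defs
open import Data.Nat using (ℕ; zero; suc; _+_; _*_; _≤_; _<_; z≤n; s≤s; ∣_-_∣)
open import Data.Nat.Properties
open import Algebra.Properties.CommutativeSemigroup +-commutativeSemigroup using (interchange)
open import Data.Bool using (Bool; true; false; _∧_; _∨_)
open import Data.Bool.Properties using (∨-zeroʳ)
open import Data.Bool.ListAction using (any)
open import Data.List using (List; []; _∷_; map; length; cartesianProduct; allFin)
open import Data.List.Properties using (length-++; length-map; length-tabulate; map-cong) renaming (≡-dec to ≡-dec-List)
open import Data.List.Membership.Propositional using (_∈_)
open import Data.List.Relation.Unary.Any using (here; there)
open import Data.List.Relation.Unary.All using (All; all?; _∷_; []) renaming (lookup to All-lookup)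
open import Data.List.Relation.Unary.AllPairs using (_∷_; [])
open import Data.List.Relation.Unary.Unique.Propositional using (Unique)
open import Data.List.Relation.Binary.Permutation.Propositional using (_↭_; ↭-refl; ↭-reflexive; ↭-sym; ↭-trans; ↭⇒↭ₛ; swap)
open import Data.List.Relation.Binary.Permutation.Propositional.Properties using (↭-singleton-inv; ∈-resp-↭; drop-mid)
open import Data.List.Relation.Binary.Pointwise using (Pointwise-≡⇒≡)
open import Data.List.Relation.Unary.Sorted.TotalOrder.Properties using (↗↭↗⇒≋)
open import Data.List.Sort.InsertionSort.Base ≤-decTotalOrder using (sort)
open import Data.List.Sort.InsertionSort.Properties ≤-decTotalOrder using (sort-↭; sort-↗)
open import Data.Fin using (Fin; toℕ; fromℕ; fromℕ<; inject₁) renaming (zero to fz; suc to fs)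
open import Data.Fin.Properties using (toℕ-injective; toℕ<n; toℕ-fromℕ; toℕ-fromℕ<; toℕ-inject₁) renaming (_≟_ to _≟F_)
open import Data.Product using (_×_; _,_; proj₁; proj₂; ∃)
open import Data.Sum using (_⊎_; inj₁; inj₂)
open import Data.Empty using (⊥-elim)
open import Function using (id)
open import Relation.Binary.PropositionalEquality
open import Relation.Binary.Definitions using (tri<; tri≈; tri>)
open import Relation.Nullary using (¬_; Dec; yes; no; does; ¬?)
open import Relation.Nullary.Decidable using (dec-true; _⊎-dec_; from-yes)

∨-true⁻ : ∀ {a b} → a ∨ b ≡ true → a ≡ true ⊎ b ≡ true
∨-true⁻ {true}  _ = inj₁ refl
∨-true⁻ {false} e = inj₂ e

∨-trueʳ : ∀ a {b} → b ≡ true → a ∨ b ≡ true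
∨-trueʳ a refl = ∨-zeroʳ a

∧-true⁻ : ∀ {a b} → a ∧ b ≡ true → a ≡ true × b ≡ true
∧-true⁻ {true} {true} _ = refl , refl

does-true⁻ : ∀ {a} {A : Set a} (d : Dec A) → does d ≡ true → A
does-true⁻ (yes p) _ = p

any-true⁺ : ∀ {A : Set} (p : A → Bool) {xs x} → x ∈ xs → p x ≡ true → any p xs ≡ true
any-true⁺ p {y ∷ _} (here refl) e rewrite e = refl
any-true⁺ p {y ∷ _} (there x∈xs) e = ∨-trueʳ (p y) (any-true⁺ p x∈xs e)

any-true⁻ : ∀ {A : Set} (p : A → Bool) xs → any p xs ≡ true → ∃ λ x → p x ≡ true
any-true⁻ p (y ∷ ys) e with ∨-true⁻ {p y} e
... | inj₁ py = y , py
... | inj₂ rest = any-true⁻ p ys rest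

module PathMetric (G : FinGraph) where
  open FinGraph G

  record IsPathMetric (δ : V → V → ℕ) : Set where
    field
      self        : ∀ u → δ u u ≡ 0
      separates   : ∀ u v → δ u v ≡ 0 → u ≡ v
      edge        : ∀ u w v → adj w v ≡ true → δ u v ≤ suc (δ u w)
      predecessor : ∀ u v d → δ u v ≡ suc d → ∃ λ w → δ u w ≡ d × adj w v ≡ true
      bounded     : ∀ u v → δ u v ≤ length verts

  module _ {δ : V → V → ℕ} (M : IsPathMetric δ) where
    open IsPathMetric M

    within-sound : ∀ k u v → within G k u v ≡ true → δ u v ≤ k
    within-sound zero u v e with does-true⁻ (u ≟V v) e
    ... | refl = ≤-reflexive (self u)
    within-sound (suc k) u v e with ∨-true⁻ {within G k u v} e
    ... | inj₁ shorter = m≤n⇒m≤1+n (within-sound k u v shorter)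
    ... | inj₂ viaLast with any-true⁻ _ verts viaLast
    ... | w , ew with ∧-true⁻ {within G k u w} ew
    ... | uw , wv = ≤-trans (edge u w v wv) (s≤s (within-sound k u w uw))

    within-complete : ∀ k u v → δ u v ≤ k → within G k u v ≡ true
    within-complete zero u v le = dec-true (u ≟V v) (separates u v (n≤0⇒n≡0 le))
    within-complete (suc k) u v le with m≤n⇒m<n∨m≡n le
    ... | inj₁ (s≤s lt) rewrite within-complete k u v lt = refl
    ... | inj₂ eq with predecessor u v k eq
    ... | w , uw , wv = ∨-trueʳ (within G k u v) (any-true⁺ _ (complete w) lastStep)
      where
      lastStep : (within G k u w ∧ adj w v) ≡ true
      lastStep rewrite within-complete k u w (≤-reflexive uw) | wv = refl

    search-exact : ∀ u v fuel k → k ≤ δ u v → δ u v ≤ k + fuel → search G k fuel u v ≡ δ u v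
    search-exact u v zero k lo hi = ≤-antisym lo (subst (δ u v ≤_) (+-identityʳ k) hi)
    search-exact u v (suc fuel) k lo hi with within G k u v in e
    ... | true = ≤-antisym lo (within-sound k u v e)
    ... | false with m≤n⇒m<n∨m≡n lo
    ... | inj₁ lt = search-exact u v fuel (suc k) lt (subst (δ u v ≤_) (+-suc k fuel) hi)
    ... | inj₂ refl with trans (sym (within-complete k u v ≤-refl)) e
    ... | ()

    dist≡ : ∀ u v → dist G u v ≡ δ u v
    dist≡ u v = search-exact u v (length verts) 0 z≤n (bounded u v)

∣n-1+n∣≡1 : ∀ a → ∣ a - suc a ∣ ≡ 1
∣n-1+n∣≡1 zero    = refl
∣n-1+n∣≡1 (suc a) = ∣n-1+n∣≡1 a

∣-∣-away : ∀ {a t} → a ≤ t → ∣ a - suc t ∣ ≡ suc ∣ a - t ∣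
∣-∣-away {zero}          _         = refl
∣-∣-away {suc a} {suc t} (s≤s a≤t) = ∣-∣-away a≤t

∣-∣-toward : ∀ {a t} → t < a → ∣ a - t ∣ ≡ suc ∣ a - suc t ∣
∣-∣-toward {suc a} {zero}  _         = cong suc (sym (∣-∣-identityʳ a))
∣-∣-toward {suc a} {suc t} (s≤s t<a) = ∣-∣-toward t<a

dist1-sound : ∀ a b → dist1 a b ≡ true → ∣ a - b ∣ ≡ 1
dist1-sound a b e with ∨-true⁻ {does (suc a ≟ b)} e
... | inj₁ up   with refl ← does-true⁻ (suc a ≟ b) up   = ∣n-1+n∣≡1 a
... | inj₂ down with refl ← does-true⁻ (suc b ≟ a) down = trans (∣-∣-comm (suc b) b) (∣n-1+n∣≡1 b)

dist1-up : ∀ a → dist1 a (suc a) ≡ true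
dist1-up a rewrite dec-true (suc a ≟ suc a) refl = refl

dist1-down : ∀ a → dist1 (suc a) a ≡ true
dist1-down a rewrite dec-true (suc a ≟ suc a) refl = ∨-zeroʳ _

Closer : ∀ {k} → ℕ → Fin k → Set
Closer {k} a b = ∃ λ (c : Fin k) → suc ∣ a - toℕ c ∣ ≡ ∣ a - toℕ b ∣ × dist1 (toℕ c) (toℕ b) ≡ true

closer-neighbour : ∀ {k} (a b : Fin k) → toℕ a ≢ toℕ b → Closer (toℕ a) b
closer-neighbour {k} a b a≢b with <-cmp (toℕ a) (toℕ b)
... | tri≈ _ a≡b _ = ⊥-elim (a≢b a≡b)
... | tri< a<b _ _ = below (toℕ a) b a<b
  where
  below : ∀ {k} a (b : Fin k) → a < toℕ b → Closer a b
  below a (fs c) (s≤s a≤c) rewrite sym (toℕ-inject₁ c) =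
    inject₁ c , sym (∣-∣-away a≤c) , dist1-up (toℕ (inject₁ c))
... | tri> _ _ b<a = c , closer , adjacent
  where
  c+1<k : suc (toℕ b) < k
  c+1<k = <-≤-trans (s≤s b<a) (toℕ<n a)
  c : Fin k
  c = fromℕ< c+1<k
  closer : suc ∣ toℕ a - toℕ c ∣ ≡ ∣ toℕ a - toℕ b ∣
  closer rewrite toℕ-fromℕ< c+1<k = sym (∣-∣-toward b<a)
  adjacent : dist1 (toℕ c) (toℕ b) ≡ true
  adjacent rewrite toℕ-fromℕ< c+1<k = dist1-down (toℕ b)

taxi : ∀ {m n} → Fin m × Fin n → Fin m × Fin n → ℕ
taxi (i , j) (i' , j') = ∣ toℕ i - toℕ i' ∣ + ∣ toℕ j - toℕ j' ∣

taxi-self : ∀ {m n} (u : Fin m × Fin n) → taxi u u ≡ 0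
taxi-self (i , j) rewrite ∣n-n∣≡0 (toℕ i) | ∣n-n∣≡0 (toℕ j) = refl

taxi-separates : ∀ {m n} (u v : Fin m × Fin n) → taxi u v ≡ 0 → u ≡ v
taxi-separates (i , j) (i' , j') e =
  cong₂ _,_ (toℕ-injective (∣m-n∣≡0⇒m≡n (m+n≡0⇒m≡0 _ e)))
            (toℕ-injective (∣m-n∣≡0⇒m≡n (m+n≡0⇒n≡0 _ e)))

taxi-comm : ∀ {m n} (u v : Fin m × Fin n) → taxi u v ≡ taxi v u
taxi-comm (i , j) (i' , j') = cong₂ _+_ (∣-∣-comm (toℕ i) (toℕ i')) (∣-∣-comm (toℕ j) (toℕ j'))

taxi-triangle : ∀ {m n} (u w v : Fin m × Fin n) → taxi u v ≤ taxi u w + taxi w v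
taxi-triangle (i , j) (i₁ , j₁) (i' , j') = ≤-trans
  (+-mono-≤ (∣-∣-triangle (toℕ i) (toℕ i₁) (toℕ i')) (∣-∣-triangle (toℕ j) (toℕ j₁) (toℕ j')))
  (≤-reflexive (interchange ∣ toℕ i - toℕ i₁ ∣ ∣ toℕ i₁ - toℕ i' ∣ ∣ toℕ j - toℕ j₁ ∣ ∣ toℕ j₁ - toℕ j' ∣))

edge⇒taxi≡1 : ∀ {m n} (w v : Fin m × Fin n) → gridAdj w v ≡ true → taxi w v ≡ 1
edge⇒taxi≡1 (i , j) (i' , j') e with ∨-true⁻ {does (i ≟F i') ∧ dist1 (toℕ j) (toℕ j')} e
... | inj₁ sameRow with ∧-true⁻ {does (i ≟F i')} sameRow
...   | i≡i' , d with refl ← does-true⁻ (i ≟F i') i≡i' =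
  trans (cong (_+ ∣ toℕ j - toℕ j' ∣) (∣n-n∣≡0 (toℕ i))) (dist1-sound (toℕ j) (toℕ j') d)
edge⇒taxi≡1 (i , j) (i' , j') e | inj₂ sameCol with ∧-true⁻ {does (j ≟F j')} sameCol
...   | j≡j' , d with refl ← does-true⁻ (j ≟F j') j≡j' =
  trans (cong (∣ toℕ i - toℕ i' ∣ +_) (∣n-n∣≡0 (toℕ j))) (trans (+-identityʳ _) (dist1-sound (toℕ i) (toℕ i') d))

row-edge : ∀ {m n} (i : Fin m) (j j' : Fin n) → dist1 (toℕ j) (toℕ j') ≡ true → gridAdj (i , j) (i , j') ≡ true
row-edge i j j' d rewrite dec-true (i ≟F i) refl | d = refl

column-edge : ∀ {m n} (i i' : Fin m) (j : Fin n) → dist1 (toℕ i) (toℕ i') ≡ true → gridAdj (i , j) (i' , j) ≡ true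
column-edge i i' j d rewrite dec-true (j ≟F j) refl | d = ∨-zeroʳ _

taxi-predecessor : ∀ {m n} (u v : Fin m × Fin n) d → taxi u v ≡ suc d →
                   ∃ λ w → taxi u w ≡ d × gridAdj w v ≡ true
taxi-predecessor (i , j) (i' , j') d e with toℕ i ≟ toℕ i'
... | no i≢i' with closer-neighbour i i' i≢i'
...   | c , closer , adjacent =
  (c , j') , suc-injective (trans (cong (_+ ∣ toℕ j - toℕ j' ∣) closer) e) , column-edge c i' j' adjacent
taxi-predecessor (i , j) (i' , j') d e | yes i≡i' with closer-neighbour j j' j≢j'
  where
  j≢j' : toℕ j ≢ toℕ j'
  j≢j' j≡j' = 0≢1+n (trans (sym (cong₂ _+_ (m≡n⇒∣m-n∣≡0 i≡i') (m≡n⇒∣m-n∣≡0 j≡j'))) e)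
...   | c , closer , adjacent = (i' , c) , suc-injective closerTaxi , row-edge i' c j' adjacent
  where
  closerTaxi : suc (∣ toℕ i - toℕ i' ∣ + ∣ toℕ j - toℕ c ∣) ≡ suc d
  closerTaxi = begin
    suc (∣ toℕ i - toℕ i' ∣ + ∣ toℕ j - toℕ c ∣) ≡⟨ sym (+-suc _ _) ⟩
    ∣ toℕ i - toℕ i' ∣ + suc ∣ toℕ j - toℕ c ∣   ≡⟨ cong (∣ toℕ i - toℕ i' ∣ +_) closer ⟩
    ∣ toℕ i - toℕ i' ∣ + ∣ toℕ j - toℕ j' ∣      ≡⟨ e ⟩
    suc d                                         ∎
    where open ≡-Reasoning

length-cartesianProduct : ∀ {A B : Set} (xs : List A) (ys : List B) →
                          length (cartesianProduct xs ys) ≡ length xs * length ys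
length-cartesianProduct []       ys = refl
length-cartesianProduct (x ∷ xs) ys =
  trans (length-++ (map (x ,_) ys)) (cong₂ _+_ (length-map (x ,_) ys) (length-cartesianProduct xs ys))

grid-size : ∀ m n → length (FinGraph.verts (grid m n)) ≡ m * n
grid-size m n = trans (length-cartesianProduct (allFin m) (allFin n))
                      (cong₂ _*_ (length-tabulate {n = m} id) (length-tabulate {n = n} id))

∣-∣<bound : ∀ {k} (a b : Fin k) → ∣ toℕ a - toℕ b ∣ < k
∣-∣<bound a b = ≤-<-trans (∣m-n∣≤m⊔n (toℕ a) (toℕ b)) (⊔-lub (toℕ<n a) (toℕ<n b))

sum≤product : ∀ {a b m n} → a < m → b < n → a + b ≤ m * n
sum≤product {a} {b} {suc m} {suc n} (s≤s a≤m) (s≤s b≤n) =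
  ≤-trans (≤-reflexive (+-comm a b)) (m≤n⇒m≤1+n (+-mono-≤ b≤n (≤-trans a≤m (m≤m*n m (suc n)))))

taxi-bounded : ∀ {m n} (u v : Fin m × Fin n) → taxi u v ≤ length (FinGraph.verts (grid m n))
taxi-bounded {m} {n} (i , j) (i' , j') =
  subst (taxi (i , j) (i' , j') ≤_) (sym (grid-size m n)) (sum≤product (∣-∣<bound i i') (∣-∣<bound j j'))

taxi-isPathMetric : ∀ m n → PathMetric.IsPathMetric (grid m n) taxi
taxi-isPathMetric m n = record
  { self        = taxi-self
  ; separates   = taxi-separates
  ; edge        = λ u w v wv → ≤-trans (taxi-triangle u w v)
                    (≤-reflexive (trans (cong (taxi u w +_) (edge⇒taxi≡1 w v wv)) (+-comm (taxi u w) 1)))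
  ; predecessor = taxi-predecessor
  ; bounded     = taxi-bounded
  }

grid-dist : ∀ {m n} (u v : Fin m × Fin n) → dist (grid m n) u v ≡ taxi u v
grid-dist {m} {n} = PathMetric.dist≡ (grid m n) (taxi-isPathMetric m n)

perm₂ : ∀ {A : Set} {a b d e : A} → (a ∷ b ∷ []) ↭ (d ∷ e ∷ []) → (a ≡ d × b ≡ e) ⊎ (a ≡ e × b ≡ d)
perm₂ p with ∈-resp-↭ p (here refl)
... | here refl with refl ← ↭-singleton-inv (↭-sym (drop-mid [] [] p)) = inj₁ (refl , refl)
... | there (here refl) with refl ← ↭-singleton-inv (drop-mid [] (_ ∷ []) p) = inj₂ (refl , refl)

data Perm₃ {A : Set} : List A → List A → Set where
  abc : ∀ {a b c} → Perm₃ (a ∷ b ∷ c ∷ []) (a ∷ b ∷ c ∷ [])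
  acb : ∀ {a b c} → Perm₃ (a ∷ b ∷ c ∷ []) (a ∷ c ∷ b ∷ [])
  bac : ∀ {a b c} → Perm₃ (a ∷ b ∷ c ∷ []) (b ∷ a ∷ c ∷ [])
  bca : ∀ {a b c} → Perm₃ (a ∷ b ∷ c ∷ []) (b ∷ c ∷ a ∷ [])
  cab : ∀ {a b c} → Perm₃ (a ∷ b ∷ c ∷ []) (c ∷ a ∷ b ∷ [])
  cba : ∀ {a b c} → Perm₃ (a ∷ b ∷ c ∷ []) (c ∷ b ∷ a ∷ [])

perm₃ : ∀ {A : Set} {a b c d e f : A} → (a ∷ b ∷ c ∷ []) ↭ (d ∷ e ∷ f ∷ []) → Perm₃ (a ∷ b ∷ c ∷ []) (d ∷ e ∷ f ∷ [])
perm₃ p with ∈-resp-↭ p (here refl)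
... | here refl with perm₂ (drop-mid [] [] p)
...   | inj₁ (refl , refl) = abc
...   | inj₂ (refl , refl) = acb
perm₃ p | there (here refl) with perm₂ (drop-mid [] (_ ∷ []) p)
...   | inj₁ (refl , refl) = bac
...   | inj₂ (refl , refl) = cab
perm₃ p | there (there (here refl)) with perm₂ (drop-mid [] (_ ∷ _ ∷ []) p)
...   | inj₁ (refl , refl) = bca
...   | inj₂ (refl , refl) = cba

triple : ℕ × ℕ → List ℕ
triple (t , c) = t ∷ suc t ∷ c ∷ []

-- {t, t+1, c} = {t', t'+1, c'} with (t , c) ≠ (t' , c') forces c = t + 2, t' = t + 1, c' = t.
Shifted : ℕ × ℕ → ℕ × ℕ → Set
Shifted (t , c) (t' , c') = t' ≡ suc t × c ≡ suc (suc t) × c' ≡ t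

-- (Exchanging the first two entries would need t = t + 2, so it does not occur.)
triple-↭ : ∀ {t c t' c'} → triple (t , c) ↭ triple (t' , c') →
           (t ≡ t' × c ≡ c') ⊎ Shifted (t , c) (t' , c') ⊎ Shifted (t' , c') (t , c)
triple-↭ p with perm₃ p
... | abc = inj₁ (refl , refl)
... | acb = inj₁ (refl , refl)
... | cba = inj₁ (refl , refl)
... | bca = inj₂ (inj₁ (refl , refl , refl))
... | cab = inj₂ (inj₂ (refl , refl , refl))

-- Distances from a point at depth x beside a path with positions 0 … K+1,
-- standing opposite position y, to the path positions 0, 1 and K+1.
lineProfile : ℕ → ℕ → ℕ → List ℕ
lineProfile K x y = x + y ∷ x + ∣ y - 1 ∣ ∷ x + ∣ y - suc K ∣ ∷ []

-- Two of these distances are consecutive, so the profile is a triple.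
lineCode : ℕ → ℕ → ℕ → ℕ × ℕ
lineCode K x zero    = x , x + suc K
lineCode K x (suc s) = x + s , x + ∣ s - K ∣

lineProfile-triple : ∀ K x y → lineProfile K x y ↭ triple (lineCode K x y)
lineProfile-triple K x zero    rewrite +-identityʳ x | +-comm x 1 = ↭-refl
lineProfile-triple K x (suc s) rewrite +-suc x s | ∣-∣-identityʳ s = swap _ _ ↭-refl

s+∣s-K∣≡K : ∀ {s K} → s ≤ K → s + ∣ s - K ∣ ≡ K
s+∣s-K∣≡K s≤K = trans (cong (_ +_) (m≤n⇒∣m-n∣≡n∸m s≤K)) (m+[n∸m]≡n s≤K)

double-injective : ∀ {x y} → x + x ≡ y + y → x ≡ y
double-injective {zero}  {zero}  _ = refl
double-injective {suc x} {suc y} e =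
  cong suc (double-injective (suc-injective (trans (sym (+-suc x x)) (trans (suc-injective e) (+-suc y y)))))

odd≢even : ∀ s d → suc (s + s) ≢ d + d
odd≢even s d e = even≢odd d s (trans (twice d) (trans (sym e) (cong suc (sym (twice s)))))
  where
  twice : ∀ x → 2 * x ≡ x + x
  twice x = cong (x +_) (+-identityʳ x)

end-vs-inner : ∀ {K x x' s'} → s' ≤ K → x ≡ x' + s' → x + suc K ≢ x' + ∣ s' - K ∣
end-vs-inner {K} {x} {x'} {s'} s'≤K t≡ c≡ = n≮n K (begin-strict
  K                 <⟨ m≤n+m (suc K) s' ⟩
  s' + suc K        ≡⟨ +-cancelˡ-≡ x' _ _ (trans (sym (+-assoc x' s' (suc K))) (trans (cong (_+ suc K) (sym t≡)) c≡)) ⟩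
  ∣ s' - K ∣        ≤⟨ m≤n+m ∣ s' - K ∣ s' ⟩
  s' + ∣ s' - K ∣   ≡⟨ s+∣s-K∣≡K s'≤K ⟩
  K                 ∎)
  where open ≤-Reasoning

lineCode-injective : ∀ {K x y x' y'} → y ≤ suc K → y' ≤ suc K →
                     proj₁ (lineCode K x y) ≡ proj₁ (lineCode K x' y') →
                     proj₂ (lineCode K x y) ≡ proj₂ (lineCode K x' y') → x ≡ x' × y ≡ y'
lineCode-injective {y = zero}  {y' = zero}   _ _ refl _ = refl , refl
lineCode-injective {y = zero}  {y' = suc _}  _ (s≤s s'≤K) t≡ c≡ = ⊥-elim (end-vs-inner s'≤K t≡ c≡)
lineCode-injective {y = suc _} {y' = zero}   (s≤s s≤K) _ t≡ c≡ = ⊥-elim (end-vs-inner s≤K (sym t≡) (sym c≡))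
lineCode-injective {K} {x} {suc s} {x'} {suc s'} (s≤s s≤K) (s≤s s'≤K) t≡ c≡ = x≡x' , cong suc s≡s'
  where
  sums : (x + x) + K ≡ (x' + x') + K
  sums = begin
    (x + x) + K                   ≡⟨ cong ((x + x) +_) (sym (s+∣s-K∣≡K s≤K)) ⟩
    (x + x) + (s + ∣ s - K ∣)     ≡⟨ interchange x x s ∣ s - K ∣ ⟩
    (x + s) + (x + ∣ s - K ∣)     ≡⟨ cong₂ _+_ t≡ c≡ ⟩
    (x' + s') + (x' + ∣ s' - K ∣) ≡⟨ interchange x' s' x' ∣ s' - K ∣ ⟩
    (x' + x') + (s' + ∣ s' - K ∣) ≡⟨ cong ((x' + x') +_) (s+∣s-K∣≡K s'≤K) ⟩
    (x' + x') + K                 ∎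
    where open ≡-Reasoning
  x≡x' : x ≡ x'
  x≡x' = double-injective (+-cancelʳ-≡ K _ _ sums)
  s≡s' : s ≡ s'
  s≡s' = +-cancelˡ-≡ x s s' (trans t≡ (cong (_+ s') (sym x≡x')))

-- The shifted coincidence is impossible: it would force K = 1, or make K both even and odd.
lineCode-unshifted : ∀ {K x y x' y'} → 2 ≤ K → y ≤ suc K → y' ≤ suc K →
                     ¬ Shifted (lineCode K x y) (lineCode K x' y')
lineCode-unshifted {K} {x} {zero} (s≤s (s≤s _)) _ _ (_ , c≡ , _) with
  +-cancelˡ-≡ x (suc K) 2 (trans c≡ (+-comm 2 x))
... | ()
lineCode-unshifted {K} {x} {suc s} {x'} {zero} _ _ _ (t'≡ , _ , c'≡) =
  m≢1+m+n x' (trans t'≡ (cong suc (sym c'≡)))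
lineCode-unshifted {K} {x} {suc s} {x'} {suc s'} _ (s≤s s≤K) (s≤s s'≤K) (t'≡ , c≡ , c'≡) =
  odd≢even s d' (suc-injective (trans (sym evenK) oddK))
  where
  d d' : ℕ
  d  = ∣ s - K ∣
  d' = ∣ s' - K ∣
  d≡ : d ≡ suc (suc s)
  d≡ = +-cancelˡ-≡ x d (suc (suc s)) (trans c≡ (sym (trans (+-suc x (suc s)) (cong suc (+-suc x s)))))
  s'≡ : s' ≡ suc d'
  s'≡ = +-cancelˡ-≡ x' s' (suc d') (trans t'≡ (trans (cong suc (sym c'≡)) (sym (+-suc x' d'))))
  evenK : K ≡ suc (suc (s + s))
  evenK = begin
    K                 ≡⟨ sym (s+∣s-K∣≡K s≤K) ⟩
    s + d             ≡⟨ cong (s +_) d≡ ⟩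
    s + suc (suc s)   ≡⟨ +-suc s (suc s) ⟩
    suc (s + suc s)   ≡⟨ cong suc (+-suc s s) ⟩
    suc (suc (s + s)) ∎
    where open ≡-Reasoning
  oddK : K ≡ suc (d' + d')
  oddK = trans (sym (s+∣s-K∣≡K s'≤K)) (cong (_+ d') s'≡)

lineProfile-injective : ∀ {K x y x' y'} → 2 ≤ K → y ≤ suc K → y' ≤ suc K →
                        lineProfile K x y ↭ lineProfile K x' y' → x ≡ x' × y ≡ y'
lineProfile-injective {K} {x} {y} {x'} {y'} 2≤K y≤ y'≤ p
  with triple-↭ (↭-trans (↭-sym (lineProfile-triple K x y)) (↭-trans p (lineProfile-triple K x' y')))
... | inj₁ (t≡ , c≡)      = lineCode-injective y≤ y'≤ t≡ c≡
... | inj₂ (inj₁ shift)  = ⊥-elim (lineCode-unshifted 2≤K y≤ y'≤ shift)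
... | inj₂ (inj₂ shift)  = ⊥-elim (lineCode-unshifted 2≤K y'≤ y≤ shift)

↭⇒sort≡ : ∀ {xs ys : List ℕ} → xs ↭ ys → sort xs ≡ sort ys
↭⇒sort≡ {xs} {ys} p = Pointwise-≡⇒≡ (↗↭↗⇒≋ ≤-totalOrder (sort-↗ xs) (sort-↗ ys)
  (↭⇒↭ₛ (↭-trans (sort-↭ xs) (↭-trans p (↭-sym (sort-↭ ys))))))

taxiProfile : ∀ {m n} (u : Fin m × Fin n) W → rm (grid m n) u W ≡ map (taxi u) W
taxiProfile u W = map-cong (grid-dist u) W

resolving-by-taxi : ∀ {m n} W → Unique W →
                    (∀ (u v : Fin m × Fin n) → u ≢ v → ¬ (map (taxi u) W ↭ map (taxi v) W)) →
                    IsMResolving (grid m n) W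
resolving-by-taxi W unique separated =
  unique , λ u v u≢v p → separated u v u≢v (subst₂ _↭_ (taxiProfile u W) (taxiProfile v W) p)

defeated : ∀ {m n} {W} (u v : Fin m × Fin n) → u ≢ v → map (taxi u) W ↭ map (taxi v) W →
           ¬ IsMResolving (grid m n) W
defeated {W = W} u v u≢v p (_ , resolves) =
  resolves u v u≢v (subst₂ _↭_ (sym (taxiProfile u W)) (sym (taxiProfile v W)) p)

neighbour : ∀ {k} → Fin (suc (suc k)) → Fin (suc (suc k))
neighbour fz     = fs fz
neighbour (fs a) = inject₁ a

neighbour-dist : ∀ {k} (a : Fin (suc (suc k))) → ∣ toℕ (neighbour a) - toℕ a ∣ ≡ 1
neighbour-dist fz     = refl
neighbour-dist (fs a) rewrite toℕ-inject₁ a = ∣n-1+n∣≡1 (toℕ a)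

neighbour-≢ : ∀ {k} (a : Fin (suc (suc k))) → neighbour a ≢ a
neighbour-≢ a na≡a with () ← trans (sym (neighbour-dist a)) (trans (cong (λ b → ∣ toℕ b - toℕ a ∣) na≡a) (∣n-n∣≡0 (toℕ a)))

-- With one landmark w, a row-neighbour and a
-- column-neighbour of w are both at distance 1; with two landmarks a, b the
-- profiles of a and b are {0, d(a,b)} and {d(a,b), 0}.
resolving-size≥3 : ∀ {m n} W → IsMResolving (grid (2 + m) (2 + n)) W → 3 ≤ length W
resolving-size≥3 [] resolving =
  ⊥-elim (defeated (fz , fz) (fs fz , fz) (λ ()) ↭-refl resolving)
resolving-size≥3 ((i , j) ∷ []) resolving =
  ⊥-elim (defeated (neighbour i , j) (i , neighbour j) (λ e → neighbour-≢ i (cong proj₁ e))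
                   (↭-reflexive (cong (_∷ []) (trans rowStep (sym columnStep)))) resolving)
  where
  rowStep : taxi (neighbour i , j) (i , j) ≡ 1
  rowStep rewrite neighbour-dist i | ∣n-n∣≡0 (toℕ j) = refl
  columnStep : taxi (i , neighbour j) (i , j) ≡ 1
  columnStep rewrite neighbour-dist j | ∣n-n∣≡0 (toℕ i) = refl
resolving-size≥3 (a ∷ b ∷ []) resolving@(((a≢b ∷ []) ∷ _) , _) =
  ⊥-elim (defeated a b a≢b mirrored resolving)
  where
  mirrored : taxi a a ∷ taxi a b ∷ [] ↭ taxi b a ∷ taxi b b ∷ []
  mirrored rewrite taxi-self a | taxi-self b | taxi-comm b a = swap 0 (taxi a b) ↭-refl
resolving-size≥3 (_ ∷ _ ∷ _ ∷ _) _ = s≤s (s≤s (s≤s z≤n))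

line-resolving : ∀ {m n K} → 2 ≤ K → (W : List (Fin m × Fin n)) → Unique W →
                 (depth pos : Fin m × Fin n → ℕ) → (∀ u → pos u ≤ suc K) →
                 (∀ u v → depth u ≡ depth v → pos u ≡ pos v → u ≡ v) →
                 (∀ u → map (taxi u) W ≡ lineProfile K (depth u) (pos u)) →
                 IsMResolving (grid m n) W
line-resolving 2≤K W unique depth pos pos≤ identifies profile = resolving-by-taxi W unique separated
  where
  separated : ∀ u v → u ≢ v → ¬ (map (taxi u) W ↭ map (taxi v) W)
  separated u v u≢v p with lineProfile-injective 2≤K (pos≤ u) (pos≤ v) (subst₂ _↭_ (profile u) (profile v) p)
  ... | depth≡ , pos≡ = u≢v (identifies u v depth≡ pos≡)

distinct₃ : ∀ {A : Set} {a b c : A} → a ≢ b → a ≢ c → b ≢ c → Unique (a ∷ b ∷ c ∷ [])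
distinct₃ a≢b a≢c b≢c = (a≢b ∷ a≢c ∷ []) ∷ (b≢c ∷ []) ∷ [] ∷ []

coordinates-injective : ∀ {m n} {i i' : Fin m} {j j' : Fin n} → toℕ i ≡ toℕ i' → toℕ j ≡ toℕ j' → (i , j) ≡ (i' , j')
coordinates-injective i≡ j≡ = cong₂ _,_ (toℕ-injective i≡) (toℕ-injective j≡)

rowLandmarks : ∀ m k → List (Fin (suc m) × Fin (4 + k))
rowLandmarks m k = (fz , fz) ∷ (fz , fs fz) ∷ (fz , fromℕ (3 + k)) ∷ []

rowLandmarks-resolving : ∀ m k → IsMResolving (grid (suc m) (4 + k)) (rowLandmarks m k)
rowLandmarks-resolving m k =
  line-resolving {K = 2 + k} (s≤s (s≤s z≤n)) (rowLandmarks m k)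
    (distinct₃ (λ ()) (λ ()) (λ ()))
    (λ (i , _) → toℕ i) (λ (_ , j) → toℕ j) (λ (_ , j) → ≤-pred (toℕ<n j))
    (λ _ _ → coordinates-injective) profile
  where
  profile : ∀ u → map (taxi u) (rowLandmarks m k) ≡ lineProfile (2 + k) (toℕ (proj₁ u)) (toℕ (proj₂ u))
  profile (i , j) rewrite ∣-∣-identityʳ (toℕ i) | ∣-∣-identityʳ (toℕ j) | toℕ-fromℕ (3 + k) = refl

columnLandmarks : ∀ k n → List (Fin (4 + k) × Fin (suc n))
columnLandmarks k n = (fz , fz) ∷ (fs fz , fz) ∷ (fromℕ (3 + k) , fz) ∷ []

columnLandmarks-resolving : ∀ k n → IsMResolving (grid (4 + k) (suc n)) (columnLandmarks k n)
columnLandmarks-resolving k n =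
  line-resolving {K = 2 + k} (s≤s (s≤s z≤n)) (columnLandmarks k n)
    (distinct₃ (λ ()) (λ ()) (λ ()))
    (λ (_ , j) → toℕ j) (λ (i , _) → toℕ i) (λ (i , _) → ≤-pred (toℕ<n i))
    (λ _ _ j≡ i≡ → coordinates-injective i≡ j≡) profile
  where
  profile : ∀ u → map (taxi u) (columnLandmarks k n) ≡ lineProfile (2 + k) (toℕ (proj₂ u)) (toℕ (proj₁ u))
  profile (i , j) rewrite ∣-∣-identityʳ (toℕ i) | ∣-∣-identityʳ (toℕ j) | toℕ-fromℕ (3 + k)
                        | +-comm (toℕ i) (toℕ j) | +-comm ∣ toℕ i - 1 ∣ (toℕ j)
                        | +-comm ∣ toℕ i - 3 + k ∣ (toℕ j) = refl

Separated : ∀ {m n} → List (Fin m × Fin n) → Fin m × Fin n → Fin m × Fin n → Set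
Separated W u v = u ≡ v ⊎ sort (map (taxi u) W) ≢ sort (map (taxi v) W)

separated? : ∀ {m n} W (u v : Fin m × Fin n) → Dec (Separated W u v)
separated? {m} {n} W u v =
  FinGraph._≟V_ (grid m n) u v ⊎-dec ¬? (≡-dec-List _≟_ (sort (map (taxi u) W)) (sort (map (taxi v) W)))

AllSeparated : ∀ m n → List (Fin m × Fin n) → Set
AllSeparated m n W = All (λ u → All (Separated W u) (FinGraph.verts (grid m n))) (FinGraph.verts (grid m n))

allSeparated? : ∀ m n W → Dec (AllSeparated m n W)
allSeparated? m n W = all? (λ u → all? (separated? W u) (FinGraph.verts (grid m n))) (FinGraph.verts (grid m n))

resolving-by-enumeration : ∀ {m n} W → Unique W → AllSeparated m n W → IsMResolving (grid m n) W
resolving-by-enumeration {m} {n} W unique checked = resolving-by-taxi W unique separated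
  where
  separated : ∀ u v → u ≢ v → ¬ (map (taxi u) W ↭ map (taxi v) W)
  separated u v u≢v p with All-lookup (All-lookup checked (FinGraph.complete (grid m n) u)) (FinGraph.complete (grid m n) v)
  ... | inj₁ u≡v   = u≢v u≡v
  ... | inj₂ sorts = sorts (↭⇒sort≡ p)

landmarks₃ₓ₂ : List (Fin 3 × Fin 2)
landmarks₃ₓ₂ = (fz , fz) ∷ (fz , fs fz) ∷ (fs (fs fz) , fz) ∷ []

landmarks₃ₓ₃ : List (Fin 3 × Fin 3)
landmarks₃ₓ₃ = (fz , fz) ∷ (fs fz , fz) ∷ (fz , fs (fs fz)) ∷ []

resolving-set-of-size-3 : ∀ {m n} → ∃ λ W → IsMResolving (grid (3 + m) (2 + n)) W × length W ≡ 3
resolving-set-of-size-3 {m}     {suc (suc k)} = rowLandmarks (2 + m) k , rowLandmarks-resolving (2 + m) k , refl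
resolving-set-of-size-3 {suc k} {n}           = columnLandmarks k (suc n) , columnLandmarks-resolving k (suc n) , refl
resolving-set-of-size-3 {0}     {0} =
  landmarks₃ₓ₂ , resolving-by-enumeration landmarks₃ₓ₂ (distinct₃ (λ ()) (λ ()) (λ ())) (from-yes (allSeparated? 3 2 landmarks₃ₓ₂)) , refl
resolving-set-of-size-3 {0}     {1} =
  landmarks₃ₓ₃ , resolving-by-enumeration landmarks₃ₓ₃ (distinct₃ (λ ()) (λ ()) (λ ())) (from-yes (allSeparated? 3 3 landmarks₃ₓ₃)) , refl

theorem4p2 : ∀ (m n : ℕ) → 3 ≤ m → 2 ≤ n → MDimIs (grid m n) 3
theorem4p2 m n (s≤s (s≤s (s≤s _))) (s≤s (s≤s _)) = resolving-set-of-size-3 , resolving-size≥3
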